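{- Let $G$ and $H$ be two connected graphs. Then: (1) if $G$ is neither a tree nor a unicyclic graph whose unique cycle is a triangle $K_3$, and $H$ contains a triangle but has no pendent edges, then $md(G * H) = 1$; (2) if $|G| \ge 2$ and $H = K_n$ with $n \ge 5$, then $md(G * H) = 1$.
   Context: The tensor product $G * H$ has vertex set $V(G)\times V(H)$, with $(u,v)$ and $(u',v')$ adjacent if and only if $uu' \in E(G)$ and $vv' \in E(H)$. A pendent edge is an edge with an endpoint of degree 1; $|G|$ is the number of vertices. An edge-coloring of a graph $G$ is a map $\Gamma: E(G) \to [k]$ (adjacent edges may receive the same color). An edge-cut is monochromatic if all of its edges have the same color. An edge-coloring of $G$ is a monochromatic disconnection coloring (MD-coloring) if any two distinct vertices $u,v$ are separated by a monochromatic edge-cut (equivalently, for some color $i$, $u$ and $v$ lie in different components of the graph obtained by deleting all edges of color $i$). For a connected graph $G$, $md(G)$ is the maximum number of colors in an MD-coloring of $G$. -}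

module Defs where

open import Data.Nat using (ℕ; zero; suc; _+_; _*_; _≤_)
open import Data.Fin using (Fin; zero; suc; inject₁; fromℕ; quotient; remainder; _≟_)
open import Data.Bool using (Bool; true; false; _∧_; if_then_else_; not)
open import Data.Bool.Properties using (∧-comm; ∧-zeroʳ)
open import Data.List using (List; map; allFin)
open import Data.Nat.ListAction using (sum)
open import Data.Product using (Σ; ∃; ∃-syntax; _×_; _,_)
open import Data.Sum using (_⊎_)
open import Relation.Nullary using (¬_; does; yes; no)
open import Data.Empty using (⊥-elim)
open import Relation.Binary.PropositionalEquality using (_≡_; _≢_; refl; cong₂; trans)
import Relation.Binary.PropositionalEquality
import Data.Nat
open import Function.Definitions using (Injective)

record Graph : Set where
  field
    size  : ℕ
    adj   : Fin size → Fin size → Bool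
    adj-sym : ∀ u v → adj u v ≡ adj v u
    irefl : ∀ u → adj u u ≡ false
open Graph public

V : Graph → Set
V G = Fin (size G)

Adj : (G : Graph) → V G → V G → Set
Adj G u v = adj G u v ≡ true

data Reach {A : Set} (E : A → A → Set) : A → A → Set where
  here : ∀ {x} → Reach E x x
  step : ∀ {x y z} → E x y → Reach E y z → Reach E x z

Connected : Graph → Set
Connected G = (0 Data.Nat.< size G) × (∀ u v → Reach (Adj G) u v)

-- a cycle of length suc m (m ≥ 2): distinct vertices f 0, …, f m,
-- consecutive ones adjacent, and f m adjacent to f 0
IsCycle : (G : Graph) {m : ℕ} → (Fin (suc m) → V G) → Set
IsCycle G {m} f =
  (2 ≤ m) × Injective _≡_ _≡_ f
  × (∀ (i : Fin m) → Adj G (f (inject₁ i)) (f (suc i)))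
  × Adj G (f (fromℕ m)) (f zero)

Acyclic : Graph → Set
Acyclic G = ∀ (m : ℕ) (f : Fin (suc m) → V G) → ¬ IsCycle G f

IsTree : Graph → Set
IsTree G = Connected G × Acyclic G

IsTriangle : (G : Graph) → V G → V G → V G → Set
IsTriangle G a b c = Adj G a b × Adj G b c × Adj G a c

HasTriangle : Graph → Set
HasTriangle G = ∃[ a ] ∃[ b ] ∃[ c ] IsTriangle G a b c

-- connected, and has exactly one cycle, which is a triangle:
-- there is a triangle abc and every cycle uses only the vertices a, b, c
-- (hence is that triangle).
IsUnicyclicTriangle : Graph → Set
IsUnicyclicTriangle G =
  Connected G ×
  (∃[ a ] ∃[ b ] ∃[ c ] (IsTriangle G a b c ×
     (∀ (m : ℕ) (f : Fin (suc m) → V G) → IsCycle G f →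
        ∀ i → (f i ≡ a) ⊎ (f i ≡ b) ⊎ (f i ≡ c))))

degree : (G : Graph) → V G → ℕ
degree G u = sum (map (λ v → if adj G u v then 1 else 0) (allFin (size G)))

NoPendentEdges : Graph → Set
NoPendentEdges G = ∀ u v → Adj G u v → (degree G u ≢ 1) × (degree G v ≢ 1)

K : ℕ → Graph
K n = record
  { size = n
  ; adj = λ u v → not (does (u ≟ v))
  ; adj-sym = λ u v → symK u v
  ; irefl = λ u → irK u }
  where
    symK : ∀ (u v : Fin n) → not (does (u ≟ v)) ≡ not (does (v ≟ u))
    symK u v with u ≟ v | v ≟ u
    ... | yes _ | yes _ = refl
    ... | no _ | no _ = refl
    ... | yes p | no q = ⊥-elim (q (Relation.Binary.PropositionalEquality.sym p))
    ... | no p | yes q = ⊥-elim (p (Relation.Binary.PropositionalEquality.sym q))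
    irK : ∀ (u : Fin n) → not (does (u ≟ u)) ≡ false
    irK u with u ≟ u
    ... | yes _ = refl
    ... | no p = ⊥-elim (p refl)

-- tensor product G * H on Fin (|G| * |H|), vertex i ↔ (quotient i, remainder i)
_⊗_ : Graph → Graph → Graph
G ⊗ H = record
  { size = size G * size H
  ; adj = λ i j → adj G (quotient {size G} (size H) i) (quotient {size G} (size H) j)
                ∧ adj H (remainder {size G} (size H) i) (remainder {size G} (size H) j)
  ; adj-sym = λ i j → cong₂ _∧_ (Graph.adj-sym G _ _) (Graph.adj-sym H _ _)
  ; irefl = λ i → trans (cong₂ _∧_ refl (Graph.irefl H _)) (∧-zeroʳ _) }

-- edge colorings with colors Fin k (value on non-edges irrelevant)
record Coloring (G : Graph) (k : ℕ) : Set where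
  field
    col     : V G → V G → Fin k
    col-sym : ∀ u v → col u v ≡ col v u
open Coloring public

UsesAll : {G : Graph} {k : ℕ} → Coloring G k → Set
UsesAll {G} {k} Γ = ∀ (i : Fin k) → ∃[ u ] ∃[ v ] (Adj G u v × col Γ u v ≡ i)

AdjWithout : {G : Graph} {k : ℕ} → Coloring G k → Fin k → V G → V G → Set
AdjWithout {G} Γ i u v = Adj G u v × (col Γ u v ≢ i)

IsMD : {G : Graph} {k : ℕ} → Coloring G k → Set
IsMD {G} Γ = ∀ (u v : V G) → u ≢ v → ∃[ i ] (¬ Reach (AdjWithout Γ i) u v)

MDColoring : Graph → ℕ → Set
MDColoring G k = Σ (Coloring G k) (λ Γ → UsesAll Γ × IsMD Γ)

md≡ : Graph → ℕ → Set
md≡ G m = MDColoring G m × (∀ k → MDColoring G k → k ≤ m)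

module Submission where

-- One colour is always an MD-colouring of a graph with an edge, so the
-- content is the upper bound.  Colour 0 against the other colours splits
-- the edges of an MD-colouring with at least two colours into two classes,
-- and this split is separating: no two distinct vertices are joined inside
-- both classes.  md≡1 reduces the theorem to showing that every separating
-- split of the product is monochromatic.  Separation forces opposite edges
-- of a 4-cycle into the same class (opposite), and likewise the edges pq
-- and pq′ when q and q′ have three common neighbours p, r, r′ (fan).
--
-- Part (2): in G ⊗ Kₙ, n ≥ 5, the fan rule equalises all edges at a vertex,
-- then all edges leaving a fibre; connectivity of G spreads this class.
--
-- Part (1): write cross x y α β for the class of the edge joining (x, β) and
-- (y, α).  By the 4-cycle rule it is invariant when the G-dart x → y and the
-- H-dart α → β advance together without backtracking.  A finite check on
-- P₄ ⊗ K₃ (Rigidity) shows that over one edge of G all six darts of a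
-- triangle of H carry the same class; this spreads to every edge of G, then
-- along non-backtracking walks of H, paired with walks of G that run
-- backwards from a cycle.  Without pendent edges these walks reach every
-- dart of H.  The cycle and the path of four distinct vertices needed exist
-- because G is neither a tree nor a unicyclic graph with triangle cycle.

open import Defs
open import Data.Nat using (ℕ; zero; suc; _≤_; _<_; z≤n; s≤s)
open import Data.Nat.Properties using (≤-trans; n<1+n; m≢1+n+m)
open import Data.Nat.ListAction using (sum)
open import Data.Fin using (Fin; zero; suc; toℕ; fromℕ; inject₁; combine; quotient; remainder; _≟_)
open import Data.Fin.Properties using (any?; pigeonhole; remQuot-combine; combine-remQuot; combine-injectiveˡ; combine-injectiveʳ; toℕ-fromℕ; toℕ-inject₁)
import Data.Fin.Properties as Fin
open import Data.Bool using (Bool; true; false; not; _∧_; if_then_else_)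
import Data.Bool as Bool
open import Data.List using (List; []; _∷_; length; lookup; tabulate)
open import Function using (_∘_)
open import Data.List.Properties using (map-tabulate)
open import Data.List.Membership.Propositional using (_∈_; _∉_)
open import Data.List.Relation.Unary.Any using (here; there; index)
import Data.List.Relation.Unary.Any as Any
open import Data.List.Relation.Unary.Any.Properties using (lookup-index)
open import Data.Product using (Σ; ∃; ∃₂; _×_; _,_; proj₁; proj₂)
open import Data.Sum using (_⊎_; inj₁; inj₂)
open import Data.Empty using (⊥; ⊥-elim)
open import Relation.Nullary using (¬_; Dec; yes; no; does)
open import Relation.Nullary.Decidable using (decidable-stable; ¬?; _×-dec_)
open import Relation.Binary.PropositionalEquality

infixr 5 _◅◅_

_◅◅_ : {A : Set} {E : A → A → Set} {x y z : A} → Reach E x y → Reach E y z → Reach E x z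
here     ◅◅ q = q
step e p ◅◅ q = step e (p ◅◅ q)

single : {A : Set} {E : A → A → Set} {x y : A} → E x y → Reach E x y
single e = step e here

reach-map : {A : Set} {E F : A → A → Set} → (∀ {x y} → E x y → F x y) →
            ∀ {x y} → Reach E x y → Reach F x y
reach-map f here       = here
reach-map f (step e p) = step (f e) (reach-map f p)

reverse : {A : Set} {E : A → A → Set} → (∀ {x y} → E x y → E y x) →
          ∀ {x y} → Reach E x y → Reach E y x
reverse flip here       = here
reverse flip (step e p) = reverse flip p ◅◅ single (flip e)

transport : {A : Set} {E : A → A → Set} (P : A → Set) → (∀ {x y} → E x y → P x → P y) →
            ∀ {x y} → Reach E x y → P x → P y
transport P carry here       px = px
transport P carry (step e p) px = transport P carry p (carry e px)

first-edge : {A : Set} {E : A → A → Set} {x y : A} → Reach E x y → x ≢ y → ∃ λ z → E x z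
first-edge here       x≢y = ⊥-elim (x≢y refl)
first-edge (step e _) x≢y = _ , e

crossing : {A : Set} {E : A → A → Set} {P : A → Set} → (∀ x → Dec (P x)) →
           ∀ {x y} → Reach E x y → P x → ¬ P y → ∃₂ λ u v → E u v × P u × ¬ P v
crossing P? here                 px ¬py = ⊥-elim (¬py px)
crossing P? (step {y = z} e p) px ¬py with P? z
... | yes pz = crossing P? p pz ¬py
... | no ¬pz = _ , _ , e , px , ¬pz

two-valued : ∀ b X → (b ≡ X) ⊎ (b ≡ not X)
two-valued false false = inj₁ refl
two-valued false true  = inj₂ refl
two-valued true  false = inj₂ refl
two-valued true  true  = inj₁ refl

∧-true : ∀ {a b} → a ∧ b ≡ true → a ≡ true × b ≡ true
∧-true {true} {true} refl = refl , refl

module _ (G : Graph) where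

  adj-flip : ∀ {u v} → Adj G u v → Adj G v u
  adj-flip {u} {v} e = trans (adj-sym G v u) e

  adj-≢ : ∀ {u v} → Adj G u v → u ≢ v
  adj-≢ {u} e refl with trans (sym e) (irefl G u)
  ... | ()

  some-edge : Connected G → 2 ≤ size G → ∃₂ λ x y → Adj G x y
  some-edge (_ , walk) (s≤s (s≤s _)) = zero , first-edge (walk zero (suc zero)) (λ ())

module Product (G H : Graph) where

  pair : V G → V H → V (G ⊗ H)
  pair = combine

  fst : V (G ⊗ H) → V G
  fst = quotient {size G} (size H)

  snd : V (G ⊗ H) → V H
  snd = remainder {size G} (size H)

  fst-pair : ∀ x α → fst (pair x α) ≡ x
  fst-pair x α = cong proj₁ (remQuot-combine {size G} {size H} x α)

  snd-pair : ∀ x α → snd (pair x α) ≡ α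
  snd-pair x α = cong proj₂ (remQuot-combine {size G} {size H} x α)

  pair-η : ∀ i → pair (fst i) (snd i) ≡ i
  pair-η = combine-remQuot {size G} (size H)

  pair-adj : ∀ {x y α β} → Adj G x y → Adj H α β → Adj (G ⊗ H) (pair x α) (pair y β)
  pair-adj {x} {y} {α} {β} xy αβ
    rewrite fst-pair x α | fst-pair y β | snd-pair x α | snd-pair y β | xy | αβ = refl

  adj-fst : ∀ {i j} → Adj (G ⊗ H) i j → Adj G (fst i) (fst j)
  adj-fst e = proj₁ (∧-true e)

  adj-snd : ∀ {i j} → Adj (G ⊗ H) i j → Adj H (snd i) (snd j)
  adj-snd e = proj₂ (∧-true e)

  pair-≢ˡ : ∀ {x y α β} → x ≢ y → pair x α ≢ pair y β
  pair-≢ˡ {x} {y} {α} {β} x≢y eq = x≢y (combine-injectiveˡ x α y β eq)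

  pair-≢ʳ : ∀ {x y α β} → α ≢ β → pair x α ≢ pair y β
  pair-≢ʳ {x} {y} {α} {β} α≢β eq = α≢β (combine-injectiveʳ x α y β eq)

ClassAdj : (Q : Graph) → (V Q → V Q → Bool) → Bool → V Q → V Q → Set
ClassAdj Q cls X u v = Adj Q u v × cls u v ≡ X

record Split (Q : Graph) : Set where
  field
    cls       : V Q → V Q → Bool
    cls-sym   : ∀ u v → cls u v ≡ cls v u
    separated : ∀ X {p q} → p ≢ q → Reach (ClassAdj Q cls X) p q →
                Reach (ClassAdj Q cls (not X)) p q → ⊥

Monochromatic : {Q : Graph} → Split Q → Set
Monochromatic {Q} S =
  ∀ {u v u′ v′} → Adj Q u v → Adj Q u′ v′ → Split.cls S u v ≡ Split.cls S u′ v′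

-- Colour zero against all other colours: an MD-colouring with at least two
-- colours is a separating split, because the colour i that disconnects p
-- from q destroys every walk of one of the two classes.
module ZeroSplit {Q : Graph} {k : ℕ} (Γ : Coloring Q (suc (suc k))) (md : IsMD Γ) where

  zero-class : V Q → V Q → Bool
  zero-class u v = does (col Γ u v ≟ zero)

  zero-class-true : ∀ {u v} → zero-class u v ≡ true → col Γ u v ≡ zero
  zero-class-true {u} {v} c with col Γ u v ≟ zero
  ... | yes is-zero = is-zero

  zero-class-false : ∀ {u v} → zero-class u v ≡ false → col Γ u v ≢ zero
  zero-class-false {u} {v} c with col Γ u v ≟ zero
  ... | no not-zero = not-zero

  both-classes : ∀ {p q} → p ≢ q → Reach (ClassAdj Q zero-class true) p q →
                 Reach (ClassAdj Q zero-class false) p q → ⊥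
  both-classes {p} {q} p≢q zeros others with md p q p≢q
  ... | i , cut with i ≟ zero
  ... | yes refl = cut (reach-map (λ (e , c) → e , zero-class-false c) others)
  ... | no i≢0   = cut (reach-map (λ (e , c) → e , λ ci → i≢0 (trans (sym ci) (zero-class-true c))) zeros)

  split : Split Q
  split = record
    { cls       = zero-class
    ; cls-sym   = λ u v → cong (λ c → does (c ≟ zero)) (col-sym Γ u v)
    ; separated = λ { true p≢q t f → both-classes p≢q t f ; false p≢q f t → both-classes p≢q t f } }

-- md(Q) = 1 as soon as Q has an edge and all its separating splits are
-- monochromatic: one colour always works, and with two or more colours the
-- edges of colour 0 and of colour 1 would lie in different classes.
md≡1 : (Q : Graph) {u v : V Q} → Adj Q u v → ((S : Split Q) → Monochromatic S) → md≡ Q 1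
md≡1 Q {u} {v} uv mono = one-colour , at-most-one
  where
  constant : Coloring Q 1
  constant = record { col = λ _ _ → zero ; col-sym = λ _ _ → refl }

  stuck : ∀ {p q} → Reach (AdjWithout constant zero) p q → p ≡ q
  stuck here             = refl
  stuck (step (_ , c) _) = ⊥-elim (c refl)

  one-colour : MDColoring Q 1
  one-colour = constant , (λ { zero → u , v , uv , refl }) , λ p q p≢q → zero , λ w → p≢q (stuck w)

  at-most-one : ∀ k → MDColoring Q k → k ≤ 1
  at-most-one zero          _ = z≤n
  at-most-one (suc zero)    _ = s≤s z≤n
  at-most-one (suc (suc k)) (Γ , uses , md)
    with uses zero | uses (suc zero)
  ... | _ , _ , e₀ , c₀ | _ , _ , e₁ , c₁
    with trans (cong (λ c → does (c ≟ zero)) (sym c₀))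
               (trans (mono (ZeroSplit.split Γ md) e₀ e₁) (cong (λ c → does (c ≟ zero)) c₁))
  ... | ()

module SplitFacts {Q : Graph} (S : Split Q) where
  open Split S public

  Class : Bool → V Q → V Q → Set
  Class = ClassAdj Q cls

  class-flip : ∀ {X u v} → Class X u v → Class X v u
  class-flip {X} {u} {v} (e , c) = adj-flip Q e , trans (cls-sym v u) c

  link : ∀ {X u v} → Adj Q u v → cls u v ≡ X → Reach (Class X) u v
  link e c = single (e , c)

  back : ∀ {X u v} → Reach (Class X) u v → Reach (Class X) v u
  back = reverse class-flip

  -- Opposite edges of a 4-cycle p q r s (with p ≠ r and q ≠ s) lie in the
  -- same class: otherwise, whatever the classes of qr and sp, some pair of
  -- the four vertices is joined inside both classes.
  opposite : ∀ {p q r s} → Adj Q p q → Adj Q q r → Adj Q r s → Adj Q s p →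
             p ≢ r → q ≢ s → cls p q ≡ cls r s
  opposite {p} {q} {r} {s} pq qr rs sp p≢r q≢s with two-valued (cls r s) (cls p q)
  ... | inj₁ same = sym same
  ... | inj₂ rs-other = ⊥-elim (by-cases (two-valued (cls q r) X) (two-valued (cls s p) X))
    where
    X : Bool
    X = cls p q

    pq′ : Reach (Class X) p q
    pq′ = link pq refl

    rs′ : Reach (Class (not X)) r s
    rs′ = link rs rs-other

    by-cases : (cls q r ≡ X) ⊎ (cls q r ≡ not X) → (cls s p ≡ X) ⊎ (cls s p ≡ not X) → ⊥
    by-cases (inj₁ qr-X) (inj₁ sp-X) =
      separated X (adj-≢ Q rs) (back (link qr qr-X) ◅◅ back pq′ ◅◅ back (link sp sp-X)) rs′
    by-cases (inj₁ qr-X) (inj₂ sp-other) =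
      separated X p≢r (pq′ ◅◅ link qr qr-X) (back (link sp sp-other) ◅◅ back rs′)
    by-cases (inj₂ qr-other) (inj₁ sp-X) =
      separated X q≢s (back pq′ ◅◅ back (link sp sp-X)) (link qr qr-other ◅◅ rs′)
    by-cases (inj₂ qr-other) (inj₂ sp-other) =
      separated X (adj-≢ Q pq) pq′ (back (link sp sp-other) ◅◅ back rs′ ◅◅ back (link qr qr-other))

  -- If q and q′ are both adjacent to p, r and r′, then pq and pq′ lie in the
  -- same class: otherwise the opposite-edge rule puts q′r, q′r′ in the class
  -- of pq and qr, qr′ in the other one, joining r and r′ inside both.
  fan : ∀ {p q q′ r r′} → Adj Q p q → Adj Q p q′ → Adj Q q r → Adj Q q′ r →
        Adj Q q r′ → Adj Q q′ r′ → p ≢ r → p ≢ r′ → q ≢ q′ → r ≢ r′ → cls p q ≡ cls p q′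
  fan {p} {q} {q′} {r} {r′} pq pq′ qr q′r qr′ q′r′ p≢r p≢r′ q≢q′ r≢r′
    with two-valued (cls p q′) (cls p q)
  ... | inj₁ same = sym same
  ... | inj₂ other =
    ⊥-elim (separated X r≢r′ (back (link q′r (via-q′ qr q′r p≢r)) ◅◅ link q′r′ (via-q′ qr′ q′r′ p≢r′))
                             (back (link qr (via-q qr q′r p≢r)) ◅◅ link qr′ (via-q qr′ q′r′ p≢r′)))
    where
    X : Bool
    X = cls p q

    via-q′ : ∀ {t} → Adj Q q t → Adj Q q′ t → p ≢ t → cls q′ t ≡ X
    via-q′ {t} qt q′t p≢t =
      trans (cls-sym q′ t) (sym (opposite pq qt (adj-flip Q q′t) (adj-flip Q pq′) p≢t q≢q′))

    via-q : ∀ {t} → Adj Q q t → Adj Q q′ t → p ≢ t → cls q t ≡ not X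
    via-q {t} qt q′t p≢t =
      trans (opposite qt (adj-flip Q q′t) (adj-flip Q pq′) pq q≢q′ (λ t≡p → p≢t (sym t≡p)))
            (trans (cls-sym q′ p) other)

fresh : ∀ {n} (xs : List (Fin n)) → length xs < n → ∃ λ c → c ∉ xs
fresh {n} xs short with any? (λ c → ¬? (Any.any? (c ≟_) xs))
... | yes missing = missing
... | no none = ⊥-elim (collision (pigeonhole short (λ c → index (listed c))))
  where
  listed : ∀ c → c ∈ xs
  listed c = decidable-stable (Any.any? (c ≟_) xs) (λ c∉xs → none (c , c∉xs))

  collision : (∃₂ λ i j → i Data.Fin.< j × index (listed i) ≡ index (listed j)) → ⊥
  collision (i , j , i<j , same) =
    Fin.<⇒≢ i<j (trans (lookup-index (listed i))
                   (trans (cong (lookup xs) same) (sym (lookup-index (listed j)))))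

two-elements : ∀ {n} → 2 ≤ n → ∃₂ λ (a b : Fin n) → a ≢ b
two-elements (s≤s (s≤s _)) = zero , suc zero , λ ()

K-adj : ∀ {n} {a b : Fin n} → a ≢ b → Adj (K n) a b
K-adj {n} {a} {b} a≢b with a ≟ b
... | yes a≡b = ⊥-elim (a≢b a≡b)
... | no _    = refl

module CompleteFactor (G : Graph) (n : ℕ) (five : 5 ≤ n) (S : Split (G ⊗ K n)) where
  open Product G (K n)
  open SplitFacts S

  -- All edges at a vertex (x, a) lie in one class: this is the fan rule,
  -- with two further vertices (x, c) and (x, c′) that n ≥ 5 provides.
  star : ∀ {x y y′ a b b′} → Adj G x y → Adj G x y′ → a ≢ b → a ≢ b′ →
         cls (pair x a) (pair y b) ≡ cls (pair x a) (pair y′ b′)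
  star {x} {y} {y′} {a} {b} {b′} xy xy′ a≢b a≢b′ with pair y b ≟ pair y′ b′
  ... | yes same = cong (cls (pair x a)) same
  ... | no apart with fresh (a ∷ b ∷ b′ ∷ []) (≤-trans (s≤s (s≤s (s≤s (s≤s z≤n)))) five)
  ... | c , c∉ with fresh (c ∷ a ∷ b ∷ b′ ∷ []) five
  ... | c′ , c′∉ =
    fan (pair-adj xy (K-adj a≢b)) (pair-adj xy′ (K-adj a≢b′))
        (pair-adj (adj-flip G xy) (K-adj b≢c)) (pair-adj (adj-flip G xy′) (K-adj b′≢c))
        (pair-adj (adj-flip G xy) (K-adj b≢c′)) (pair-adj (adj-flip G xy′) (K-adj b′≢c′))
        (pair-≢ʳ a≢c) (pair-≢ʳ a≢c′) apart (pair-≢ʳ c≢c′)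
    where
    a≢c : a ≢ c
    a≢c a≡c = c∉ (here (sym a≡c))
    b≢c : b ≢ c
    b≢c b≡c = c∉ (there (here (sym b≡c)))
    b′≢c : b′ ≢ c
    b′≢c b′≡c = c∉ (there (there (here (sym b′≡c))))
    c≢c′ : c ≢ c′
    c≢c′ c≡c′ = c′∉ (here (sym c≡c′))
    a≢c′ : a ≢ c′
    a≢c′ a≡c′ = c′∉ (there (here (sym a≡c′)))
    b≢c′ : b ≢ c′
    b≢c′ b≡c′ = c′∉ (there (there (here (sym b≡c′))))
    b′≢c′ : b′ ≢ c′
    b′≢c′ b′≡c′ = c′∉ (there (there (there (here (sym b′≡c′)))))

  -- All edges leaving the fibre of x lie in one class: edges at (x, a) and
  -- at (x, a′) both share the class of an edge back from some (y, d) with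
  -- d ∉ {a, a′}.
  fibre : ∀ {x y y′ a b a′ b′} → Adj G x y → Adj G x y′ → a ≢ b → a′ ≢ b′ →
          cls (pair x a) (pair y b) ≡ cls (pair x a′) (pair y′ b′)
  fibre {x} {y} {y′} {a} {b} {a′} {b′} xy xy′ a≢b a′≢b′
    with fresh (a ∷ a′ ∷ []) (≤-trans (s≤s (s≤s (s≤s z≤n))) five)
  ... | d , d∉ = begin
    cls (pair x a) (pair y b)     ≡⟨ star xy xy a≢b a≢d ⟩
    cls (pair x a) (pair y d)     ≡⟨ cls-sym _ _ ⟩
    cls (pair y d) (pair x a)     ≡⟨ star yx yx (≢-sym a≢d) (≢-sym a′≢d) ⟩
    cls (pair y d) (pair x a′)    ≡⟨ cls-sym _ _ ⟩
    cls (pair x a′) (pair y d)    ≡⟨ star xy xy′ a′≢d a′≢b′ ⟩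
    cls (pair x a′) (pair y′ b′)  ∎
    where
    open ≡-Reasoning
    yx : Adj G y x
    yx = adj-flip G xy
    a≢d : a ≢ d
    a≢d a≡d = d∉ (here (sym a≡d))
    a′≢d : a′ ≢ d
    a′≢d a′≡d = d∉ (there (here (sym a′≡d)))

  FibreClass : Bool → V G → Set
  FibreClass X x = ∀ {y a b} → Adj G x y → a ≢ b → cls (pair x a) (pair y b) ≡ X

  -- The fibre class passes to a neighbour y of x, through an edge from
  -- (y, a) back to the fibre of x.
  fibre-step : ∀ {X x y} → FibreClass X x → Adj G x y → FibreClass X y
  fibre-step {X} {x} {y} fx xy {z} {a} {b} yz a≢b
    with fresh (a ∷ []) (≤-trans (s≤s (s≤s z≤n)) five)
  ... | d , d∉ = trans (fibre yz (adj-flip G xy) a≢b a≢d) (trans (cls-sym _ _) (fx xy (≢-sym a≢d)))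
    where
    a≢d : a ≢ d
    a≢d a≡d = d∉ (here (sym a≡d))

  monochromatic : Connected G → ∀ {x₀ y₀} → Adj G x₀ y₀ → Monochromatic S
  monochromatic (_ , walk) {x₀} {y₀} x₀y₀ e e′ = trans (edge-class e) (sym (edge-class e′))
    where
    corners : ∃₂ λ (a b : Fin n) → a ≢ b
    corners = two-elements (≤-trans (s≤s (s≤s z≤n)) five)

    a₀ b₀ : Fin n
    a₀ = proj₁ corners
    b₀ = proj₁ (proj₂ corners)

    X : Bool
    X = cls (pair x₀ a₀) (pair y₀ b₀)

    everywhere : ∀ x → FibreClass X x
    everywhere x = transport (FibreClass X) (λ xy fx → fibre-step fx xy) (walk x₀ x)
                             (λ xy a≢b → fibre xy x₀y₀ a≢b (proj₂ (proj₂ corners)))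

    edge-class : ∀ {i j} → Adj (G ⊗ K n) i j → cls i j ≡ X
    edge-class {i} {j} e = subst₂ (λ p q → cls p q ≡ X) (pair-η i) (pair-η j)
                                  (everywhere (fst i) (adj-fst e) (adj-≢ (K n) (adj-snd e)))

sum-zero : ∀ {n} (g : Fin n → ℕ) → (∀ w → g w ≡ 0) → sum (tabulate g) ≡ 0
sum-zero {zero}  g zeros = refl
sum-zero {suc n} g zeros rewrite zeros zero = sum-zero (g ∘ suc) (zeros ∘ suc)

sum-single : ∀ {n} (g : Fin n → ℕ) (u : Fin n) → g u ≡ 1 → (∀ w → w ≢ u → g w ≡ 0) →
             sum (tabulate g) ≡ 1
sum-single {suc n} g zero one rest
  rewrite one | sum-zero (g ∘ suc) (λ w → rest (suc w) (λ ())) = refl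
sum-single {suc n} g (suc u) one rest rewrite rest zero (λ ()) =
  sum-single (g ∘ suc) u one (λ w w≢u → rest (suc w) (w≢u ∘ Fin.suc-injective))

degree-one : (H : Graph) {u v : V H} → Adj H v u → (∀ w → Adj H v w → w ≡ u) → degree H v ≡ 1
degree-one H {u} {v} vu only =
  trans (cong sum (map-tabulate (λ w → w) indicator)) (sum-single indicator u at-u elsewhere)
  where
  indicator : V H → ℕ
  indicator w = if adj H v w then 1 else 0

  at-u : indicator u ≡ 1
  at-u rewrite vu = refl

  elsewhere : ∀ w → w ≢ u → indicator w ≡ 0
  elsewhere w w≢u with adj H v w in vw
  ... | true  = ⊥-elim (w≢u (only w vw))
  ... | false = refl

continue : (H : Graph) → NoPendentEdges H → ∀ {u v} → Adj H u v → ∃ λ w → Adj H v w × w ≢ u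
continue H no-pendent {u} {v} uv
  with any? (λ w → (adj H v w Bool.≟ true) ×-dec ¬? (w ≟ u))
... | yes onward = onward
... | no none = ⊥-elim (proj₂ (no-pendent u v uv) (degree-one H (adj-flip H uv) only))
  where
  only : ∀ w → Adj H v w → w ≡ u
  only w vw = decidable-stable (w ≟ u) (λ w≢u → none (w , vw , w≢u))

-- Darts of G reachable from a set of seed darts by non-backtracking steps.
-- The seeds are closed under non-backtracking predecessors, hence so is the
-- set of reachable darts.
module NonBacktracking (G : Graph) (Seed : V G → V G → Set)
  (seed-adj : ∀ {u v} → Seed u v → Adj G u v)
  (seed-back : ∀ {u v} → Seed u v → ∃ λ t → Seed t u × t ≢ v) where

  data NB : V G → V G → Set where
    seed   : ∀ {u v} → Seed u v → NB u v
    extend : ∀ {u v w} → NB u v → Adj G v w → u ≢ w → NB v w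

  NB-adj : ∀ {u v} → NB u v → Adj G u v
  NB-adj (seed s)        = seed-adj s
  NB-adj (extend _ vw _) = vw

  NB-back : ∀ {u v} → NB u v → ∃ λ t → NB t u × t ≢ v
  NB-back (seed s) with seed-back s
  ... | t , ts , t≢v = t , seed ts , t≢v
  NB-back (extend tu _ t≢w) = _ , tu , t≢w

  Entered : V G → Set
  Entered v = ∃ λ u → NB u v

  orient : ∀ {v w} → Entered v → Adj G v w → NB v w ⊎ NB w v
  orient {v} {w} (u , uv) vw with u ≟ w
  ... | yes refl = inj₂ uv
  ... | no u≢w   = inj₁ (extend uv vw u≢w)

  -- Entering propagates to neighbours (through the predecessor of w → v
  -- when only that direction is reachable).
  entered-step : ∀ {v w} → Entered v → Adj G v w → Entered w
  entered-step ev vw with orient ev vw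
  ... | inj₁ vw′ = _ , vw′
  ... | inj₂ wv with NB-back wv
  ...   | t , tw , _ = t , tw

  oriented : (∀ u v → Reach (Adj G) u v) → ∀ {s t} → Seed s t →
             ∀ {v w} → Adj G v w → NB v w ⊎ NB w v
  oriented walk {s} {t} st {v} =
    orient (transport Entered (λ e ev → entered-step ev e) (walk t v) (s , seed st))

  -- In a connected graph in which every dart continues, and in which all
  -- darts leaving some root r are reachable, every dart is reachable (in the
  -- double-negation sense; reachability is not decidable a priori).
  module AllDarts (walk : ∀ u v → Reach (Adj G) u v)
                  (continues : ∀ {u v} → Adj G u v → ∃ λ w → Adj G v w × w ≢ u)
                  (r : V G) (root : ∀ {y} → Adj G r y → NB r y) where

    Bad : V G → Set
    Bad x = ∃ λ y → Adj G x y × ¬ NB x y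

    -- A reachable dart z → x with unreachable reverse, where z is not bad,
    -- is impossible: continuing from it forever keeps every reverse dart
    -- unreachable, and the first repeated vertex of the walk yields a
    -- reachable reverse dart (or a bad dart at z).
    module Loop {z x : V G} (zx : NB z x) (xz : ¬ NB x z) (good-z : ¬ Bad z) where

      Arc : Set
      Arc = Σ (V G × V G) λ uv → Adj G (proj₁ uv) (proj₂ uv)

      next : Arc → Arc
      next ((u , v) , uv) = (v , proj₁ (continues uv)) , proj₁ (proj₂ (continues uv))

      arc : ℕ → Arc
      arc zero    = (z , x) , NB-adj zx
      arc (suc n) = next (arc n)

      s : ℕ → V G
      s n = proj₁ (proj₁ (arc n))

      walk-adj : ∀ n → Adj G (s n) (s (suc n))
      walk-adj n = proj₂ (arc n)

      no-return : ∀ n → s (suc (suc n)) ≢ s n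
      no-return n = proj₂ (proj₂ (continues (proj₂ (arc n))))

      forward : ∀ n → NB (s n) (s (suc n))
      forward zero    = zx
      forward (suc n) = extend (forward n) (walk-adj (suc n)) (≢-sym (no-return n))

      backward : ∀ n → ¬ NB (s (suc n)) (s n)
      backward zero    = xz
      backward (suc n) nb = backward n (extend nb (adj-flip G (walk-adj n)) (no-return n))

      -- A first repetition s i = s j would make the backward dart
      -- s (i + 1) → s i reachable from the forward dart s (j − 1) → s j, or
      -- (for i = 0) exhibit an unreachable dart leaving z.
      no-repeat : ∀ i j → i < j → s i ≢ s j
      no-repeat zero (suc j) _ z≡sj =
        good-z (s j , subst (λ t → Adj G t (s j)) (sym z≡sj) (adj-flip G (walk-adj j))
                    , subst (λ t → ¬ NB t (s j)) (sym z≡sj) (backward j))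
      no-repeat (suc i) (suc j) (s≤s i<j) si≡sj with s i ≟ s j
      ... | yes earlier = no-repeat i j i<j earlier
      ... | no differ =
        backward i (subst (λ t → NB t (s i)) (sym si≡sj)
                      (extend (forward j) (subst (λ t → Adj G t (s i)) si≡sj (adj-flip G (walk-adj i)))
                              (≢-sym differ)))

      -- The walk is infinite but G is finite.
      impossible : ⊥
      impossible with pigeonhole (n<1+n (size G)) (λ i → s (toℕ i))
      ... | i , j , i<j , same = no-repeat (toℕ i) (toℕ j) i<j same

    -- Badness cannot stop at an edge x z: an unreachable dart x → y either
    -- makes z → x unreachable (y ≠ z) or falls under the loop argument (y = z).
    bad-spreads : ∀ {x z} → Adj G x z → Bad x → ¬ Bad z → ⊥
    bad-spreads {x} {z} xz (y , xy , ¬xy) good-z with y ≟ z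
    ... | no y≢z = good-z (x , adj-flip G xz , λ zx → ¬xy (extend zx xy (≢-sym y≢z)))
    ... | yes refl = good-z (x , adj-flip G xz , λ zx → Loop.impossible zx ¬xy good-z)

    -- Badness would spread from the tail of an unreachable dart to the root.
    every-dart : ∀ {v w} → Adj G v w → ¬ ¬ NB v w
    every-dart {v} {w} vw ¬vw =
      transport (λ x → ¬ ¬ Bad x) (λ xz ¬¬bad good → ¬¬bad (λ bad → bad-spreads xz bad good))
                (walk v r) (λ good → good (w , vw , ¬vw)) (λ (y , ry , ¬ry) → ¬ry (root ry))

data LastView : ∀ {m} → Fin (suc m) → Set where
  last  : ∀ {m} → LastView (fromℕ m)
  inner : ∀ {m} (i : Fin m) → LastView (inject₁ i)

last-view : ∀ {m} (j : Fin (suc m)) → LastView j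
last-view {zero}  zero    = last
last-view {suc m} zero    = inner zero
last-view {suc m} (suc j) with last-view j
... | last    = last
... | inner i = inner (suc i)

module CycleSeeds (G : Graph) {m : ℕ} (f : Fin (suc m) → V G) (cycle : IsCycle G f) where

  succ : Fin (suc m) → Fin (suc m)
  succ j with last-view j
  ... | last    = zero
  ... | inner i = suc i

  succ-adj : ∀ j → Adj G (f j) (f (succ j))
  succ-adj j with last-view j
  ... | last    = proj₂ (proj₂ (proj₂ cycle))
  ... | inner i = proj₁ (proj₂ (proj₂ cycle)) i

  succ-toℕ : ∀ j → (toℕ j ≡ m × succ j ≡ zero) ⊎ (toℕ (succ j) ≡ suc (toℕ j))
  succ-toℕ j with last-view j
  ... | last    = inj₁ (toℕ-fromℕ m , refl)
  ... | inner i = inj₂ (cong suc (sym (toℕ-inject₁ i)))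

  m≢0 : m ≢ 0
  m≢0 with proj₁ cycle
  ... | s≤s (s≤s _) = λ ()

  m≢1 : m ≢ 1
  m≢1 with proj₁ cycle
  ... | s≤s (s≤s _) = λ ()

  -- Two successor steps never return, as the cycle has length at least 3.
  succ-succ : ∀ j → succ (succ j) ≢ j
  succ-succ j ss≡j with succ-toℕ j | succ-toℕ (succ j)
  ... | inj₁ (_ , sj≡0) | inj₁ (sj-last , _) = m≢0 (trans (sym sj-last) (cong toℕ sj≡0))
  ... | inj₁ (j-last , sj≡0) | inj₂ ss-step =
    m≢1 (trans (sym j-last) (trans (cong toℕ (sym ss≡j)) (trans ss-step (cong (suc ∘ toℕ) sj≡0))))
  ... | inj₂ s-step | inj₁ (sj-last , ss≡0) =
    m≢1 (trans (sym sj-last) (trans s-step (cong suc (trans (cong toℕ (sym ss≡j)) (cong toℕ ss≡0)))))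
  ... | inj₂ s-step | inj₂ ss-step =
    m≢1+n+m (toℕ j) (trans (cong toℕ (sym ss≡j)) (trans ss-step (cong suc s-step)))

  data CycleDart : V G → V G → Set where
    backward : ∀ j → CycleDart (f (succ j)) (f j)

  cycle-adj : ∀ {u v} → CycleDart u v → Adj G u v
  cycle-adj (backward j) = adj-flip G (succ-adj j)

  cycle-back : ∀ {u v} → CycleDart u v → ∃ λ t → CycleDart t u × t ≢ v
  cycle-back (backward j) =
    f (succ (succ j)) , backward (succ j) , λ same → succ-succ j (proj₁ (proj₂ cycle) same)

data Corner : Set where
  A B C : Corner

data Spin : Set where
  ↻ ↺ : Spin

turn : Spin → Corner → Corner
turn ↻ A = B
turn ↻ B = C
turn ↻ C = A
turn ↺ A = C
turn ↺ B = A
turn ↺ C = B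

Dart : Set
Dart = Corner × Spin

tail head : Dart → Corner
tail   = proj₁
head d = turn (proj₂ d) (proj₁ d)

opposite-spin : Spin → Spin
opposite-spin ↻ = ↺
opposite-spin ↺ = ↻

next prev rev : Dart → Dart
next d       = head d , proj₂ d
prev (u , s) = turn s (turn s u) , s
rev d        = head d , opposite-spin (proj₂ d)

next-prev : ∀ d → next (prev d) ≡ d
next-prev (A , ↻) = refl
next-prev (B , ↻) = refl
next-prev (C , ↻) = refl
next-prev (A , ↺) = refl
next-prev (B , ↺) = refl
next-prev (C , ↺) = refl

head-rev : ∀ d → head (rev d) ≡ tail d
head-rev (A , ↻) = refl
head-rev (B , ↻) = refl
head-rev (C , ↻) = refl
head-rev (A , ↺) = refl
head-rev (B , ↺) = refl
head-rev (C , ↺) = refl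

AB BC CA BA CB AC : Dart
AB = A , ↻
BC = B , ↻
CA = C , ↻
BA = B , ↺
CB = C , ↺
AC = A , ↺

module Triangle (H : Graph) (a b c : V H) (ab : Adj H a b) (bc : Adj H b c) (ac : Adj H a c) where

  corner : Corner → V H
  corner A = a
  corner B = b
  corner C = c

  dart-adj : ∀ d → Adj H (corner (tail d)) (corner (head d))
  dart-adj (A , ↻) = ab
  dart-adj (B , ↻) = bc
  dart-adj (C , ↻) = adj-flip H ac
  dart-adj (A , ↺) = ac
  dart-adj (B , ↺) = adj-flip H ab
  dart-adj (C , ↺) = adj-flip H bc

  turn-twice : ∀ d → corner (tail d) ≢ corner (head (next d))
  turn-twice (A , ↻) = adj-≢ H ac
  turn-twice (B , ↻) = adj-≢ H (adj-flip H ab)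
  turn-twice (C , ↻) = adj-≢ H (adj-flip H bc)
  turn-twice (A , ↺) = adj-≢ H ab
  turn-twice (B , ↺) = adj-≢ H bc
  turn-twice (C , ↺) = adj-≢ H (adj-flip H ac)

  corner-injective : ∀ {u v} → corner u ≡ corner v → u ≡ v
  corner-injective {A} {A} _   = refl
  corner-injective {A} {B} a≡b = ⊥-elim (adj-≢ H ab a≡b)
  corner-injective {A} {C} a≡c = ⊥-elim (adj-≢ H ac a≡c)
  corner-injective {B} {A} b≡a = ⊥-elim (adj-≢ H ab (sym b≡a))
  corner-injective {B} {B} _   = refl
  corner-injective {B} {C} b≡c = ⊥-elim (adj-≢ H bc b≡c)
  corner-injective {C} {A} c≡a = ⊥-elim (adj-≢ H ac (sym c≡a))
  corner-injective {C} {B} c≡b = ⊥-elim (adj-≢ H bc (sym c≡b))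
  corner-injective {C} {C} _   = refl

  InTriangle : V H → Set
  InTriangle v = ∃ λ u → corner u ≡ v

  in-triangle? : ∀ v → Dec (InTriangle v)
  in-triangle? v with a ≟ v | b ≟ v | c ≟ v
  ... | yes a≡v | _       | _       = yes (A , a≡v)
  ... | no _    | yes b≡v | _       = yes (B , b≡v)
  ... | no _    | no _    | yes c≡v = yes (C , c≡v)
  ... | no a≢v  | no b≢v  | no c≢v  = no λ { (A , a≡v) → a≢v a≡v ; (B , b≡v) → b≢v b≡v ; (C , c≡v) → c≢v c≡v }

data Layer : Set where
  ℓ₀ ℓ₁ ℓ₂ ℓ₃ : Layer

module TensorFacts (G H : Graph) (S : Split (G ⊗ H)) where
  open Product G H public
  open SplitFacts S public

  -- The class of the edge joining (x, β) and (y, α), read along the G-dart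
  -- x → y and the H-dart α → β.
  cross : V G → V G → V H → V H → Bool
  cross x y α β = cls (pair x β) (pair y α)

  -- The class does not change when both darts advance without
  -- backtracking: the two edges are opposite in a 4-cycle.
  cross-step : ∀ {x y z α β γ} → Adj G x y → Adj G y z → x ≢ z →
               Adj H α β → Adj H β γ → α ≢ γ → cross x y α β ≡ cross y z β γ
  cross-step {x} {y} {z} {α} {β} {γ} xy yz x≢z αβ βγ α≢γ =
    trans (cls-sym (pair x β) (pair y α))
          (opposite (pair-adj (adj-flip G xy) αβ) (pair-adj xy βγ)
                    (pair-adj yz (adj-flip H βγ)) (pair-adj (adj-flip G yz) (adj-flip H αβ))
                    (pair-≢ʳ α≢γ) (pair-≢ˡ x≢z))

  -- Rigidity: over the first edge of a path x₀ x₁ x₂ x₃ (the four vertices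
  -- distinct), the six darts of any triangle of H all carry the same class.
  -- The edges of P₄ ⊗ K₃ above the path fall into six groups of equal class,
  -- one per dart at layer 0 (cross-step); every separation witness in this
  -- 12-vertex graph involves all six groups, so each non-constant pattern
  -- must be refuted separately.  Up to symmetries of the triangle it
  -- suffices to show that two consecutive darts agree (16 patterns) and
  -- then that the two orientations agree (one pattern); each refutation is
  -- a hexagon with one run of each class.
  module Rigidity (x₀ x₁ x₂ x₃ : V G) (g₀₁ : Adj G x₀ x₁) (g₁₂ : Adj G x₁ x₂) (g₂₃ : Adj G x₂ x₃)
                  (x₀≢x₂ : x₀ ≢ x₂) (x₁≢x₃ : x₁ ≢ x₃) (x₀≢x₃ : x₀ ≢ x₃) where

    layer : Layer → V G
    layer ℓ₀ = x₀
    layer ℓ₁ = x₁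
    layer ℓ₂ = x₂
    layer ℓ₃ = x₃

    layer-injective : ∀ {i j} → layer i ≡ layer j → i ≡ j
    layer-injective {ℓ₀} {ℓ₀} _ = refl
    layer-injective {ℓ₀} {ℓ₁} e = ⊥-elim (adj-≢ G g₀₁ e)
    layer-injective {ℓ₀} {ℓ₂} e = ⊥-elim (x₀≢x₂ e)
    layer-injective {ℓ₀} {ℓ₃} e = ⊥-elim (x₀≢x₃ e)
    layer-injective {ℓ₁} {ℓ₀} e = ⊥-elim (adj-≢ G g₀₁ (sym e))
    layer-injective {ℓ₁} {ℓ₁} _ = refl
    layer-injective {ℓ₁} {ℓ₂} e = ⊥-elim (adj-≢ G g₁₂ e)
    layer-injective {ℓ₁} {ℓ₃} e = ⊥-elim (x₁≢x₃ e)
    layer-injective {ℓ₂} {ℓ₀} e = ⊥-elim (x₀≢x₂ (sym e))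
    layer-injective {ℓ₂} {ℓ₁} e = ⊥-elim (adj-≢ G g₁₂ (sym e))
    layer-injective {ℓ₂} {ℓ₂} _ = refl
    layer-injective {ℓ₂} {ℓ₃} e = ⊥-elim (adj-≢ G g₂₃ e)
    layer-injective {ℓ₃} {ℓ₀} e = ⊥-elim (x₀≢x₃ (sym e))
    layer-injective {ℓ₃} {ℓ₁} e = ⊥-elim (x₁≢x₃ (sym e))
    layer-injective {ℓ₃} {ℓ₂} e = ⊥-elim (adj-≢ G g₂₃ (sym e))
    layer-injective {ℓ₃} {ℓ₃} _ = refl

    module Oriented (a b c : V H) (ab : Adj H a b) (bc : Adj H b c) (ac : Adj H a c) where
      open Triangle H a b c ab bc ac

      pt : Layer × Corner → V (G ⊗ H)
      pt (i , u) = pair (layer i) (corner u)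

      apart : ∀ s t → s ≢ t → pt s ≢ pt t
      apart (i , u) (j , v) s≢t same =
        s≢t (cong₂ _,_ (layer-injective (combine-injectiveˡ (layer i) (corner u) (layer j) (corner v) same))
                       (corner-injective (combine-injectiveʳ (layer i) (corner u) (layer j) (corner v) same)))

      κ : Dart → Bool
      κ d = cross x₀ x₁ (corner (tail d)) (corner (head d))

      shift₁ : ∀ d → cross x₁ x₂ (corner (tail (next d))) (corner (head (next d))) ≡ κ d
      shift₁ d = sym (cross-step g₀₁ g₁₂ x₀≢x₂ (dart-adj d) (dart-adj (next d)) (turn-twice d))

      shift₂ : ∀ d → cross x₂ x₃ (corner (tail (next (next d)))) (corner (head (next (next d)))) ≡ κ d
      shift₂ d = trans (sym (cross-step g₁₂ g₂₃ x₁≢x₃ (dart-adj (next d)) (dart-adj (next (next d)))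
                                        (turn-twice (next d))))
                       (shift₁ d)

      up₀ : ∀ {Y} d → κ d ≡ Y → Reach (Class Y) (pt (ℓ₀ , head d)) (pt (ℓ₁ , tail d))
      up₀ d h = link (pair-adj g₀₁ (adj-flip H (dart-adj d))) h

      up₁ : ∀ {Y} d → κ d ≡ Y → Reach (Class Y) (pt (ℓ₁ , head (next d))) (pt (ℓ₂ , tail (next d)))
      up₁ d h = link (pair-adj g₁₂ (adj-flip H (dart-adj (next d)))) (trans (shift₁ d) h)

      up₂ : ∀ {Y} d → κ d ≡ Y →
            Reach (Class Y) (pt (ℓ₂ , head (next (next d)))) (pt (ℓ₃ , tail (next (next d))))
      up₂ d h = link (pair-adj g₂₃ (adj-flip H (dart-adj (next (next d))))) (trans (shift₂ d) h)

      dn₀ : ∀ {Y} d → κ d ≡ Y → Reach (Class Y) (pt (ℓ₁ , tail d)) (pt (ℓ₀ , head d))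
      dn₀ d h = back (up₀ d h)

      dn₁ : ∀ {Y} d → κ d ≡ Y → Reach (Class Y) (pt (ℓ₂ , tail (next d))) (pt (ℓ₁ , head (next d)))
      dn₁ d h = back (up₁ d h)

      clash : ∀ Y s t → s ≢ t → Reach (Class Y) (pt s) (pt t) → Reach (Class (not Y)) (pt s) (pt t) → ⊥
      clash Y s t s≢t = separated Y (apart s t s≢t)

      -- In each of the 16
      -- patterns for the other four darts, some hexagon of P₄ ⊗ K₃ splits
      -- into a walk of class X and a walk of class not X with common ends.
      consecutive : κ AB ≡ κ BC
      consecutive with two-valued (κ BC) (κ AB)
      ... | inj₁ same = sym same
      ... | inj₂ other = ⊥-elim (refute refl other)
        where
        refute : ∀ {X} → κ AB ≡ X → κ BC ≡ not X → ⊥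
        refute {X} hAB hBC
          with two-valued (κ CA) X | two-valued (κ BA) X | two-valued (κ CB) X | two-valued (κ AC) X
        ... | inj₁ hCA | inj₁ hBA | inj₁ hCB | inj₁ hAC =
          clash X (ℓ₀ , C) (ℓ₁ , B) (λ ())
            (up₀ AC hAC ◅◅ dn₀ AB hAB ◅◅ up₀ CB hCB ◅◅ dn₀ CA hCA ◅◅ up₀ BA hBA)
            (up₀ BC hBC)
        ... | inj₁ hCA | inj₁ hBA | inj₁ hCB | inj₂ hAC =
          clash X (ℓ₁ , A) (ℓ₁ , B) (λ ())
            (dn₀ AB hAB ◅◅ up₀ CB hCB ◅◅ dn₀ CA hCA ◅◅ up₀ BA hBA)
            (dn₀ AC hAC ◅◅ up₀ BC hBC)
        ... | inj₁ hCA | inj₁ hBA | inj₂ hCB | inj₁ hAC =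
          clash X (ℓ₂ , B) (ℓ₂ , C) (λ ())
            (dn₁ AB hAB ◅◅ dn₀ CA hCA ◅◅ up₀ BA hBA ◅◅ up₁ AC hAC)
            (dn₁ CB hCB ◅◅ up₁ BC hBC)
        ... | inj₁ hCA | inj₁ hBA | inj₂ hCB | inj₂ hAC =
          clash X (ℓ₁ , B) (ℓ₂ , B) (λ ())
            (dn₀ BA hBA ◅◅ up₀ CA hCA ◅◅ up₁ AB hAB)
            (dn₀ BC hBC ◅◅ up₀ AC hAC ◅◅ up₁ CB hCB)
        ... | inj₁ hCA | inj₂ hBA | inj₁ hCB | inj₁ hAC =
          clash X (ℓ₀ , A) (ℓ₀ , C) (λ ())
            (up₀ CA hCA ◅◅ dn₀ CB hCB ◅◅ up₀ AB hAB ◅◅ dn₀ AC hAC)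
            (up₀ BA hBA ◅◅ dn₀ BC hBC)
        ... | inj₁ hCA | inj₂ hBA | inj₁ hCB | inj₂ hAC =
          clash X (ℓ₀ , A) (ℓ₁ , A) (λ ())
            (up₀ CA hCA ◅◅ dn₀ CB hCB ◅◅ up₀ AB hAB)
            (up₀ BA hBA ◅◅ dn₀ BC hBC ◅◅ up₀ AC hAC)
        ... | inj₁ hCA | inj₂ hBA | inj₂ hCB | inj₁ hAC =
          clash X (ℓ₂ , C) (ℓ₃ , C) (λ ())
            (dn₁ AC hAC ◅◅ up₁ CA hCA ◅◅ up₂ AB hAB)
            (dn₁ BC hBC ◅◅ up₁ CB hCB ◅◅ up₂ BA hBA)
        ... | inj₁ hCA | inj₂ hBA | inj₂ hCB | inj₂ hAC =
          clash X (ℓ₀ , A) (ℓ₂ , B) (λ ())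
            (up₀ CA hCA ◅◅ up₁ AB hAB)
            (up₀ BA hBA ◅◅ dn₀ BC hBC ◅◅ up₀ AC hAC ◅◅ up₁ CB hCB)
        ... | inj₂ hCA | inj₁ hBA | inj₁ hCB | inj₁ hAC =
          clash X (ℓ₀ , C) (ℓ₂ , A) (λ ())
            (up₀ AC hAC ◅◅ dn₀ AB hAB ◅◅ up₀ CB hCB ◅◅ up₁ BA hBA)
            (up₀ BC hBC ◅◅ up₁ CA hCA)
        ... | inj₂ hCA | inj₁ hBA | inj₁ hCB | inj₂ hAC =
          clash X (ℓ₁ , A) (ℓ₂ , A) (λ ())
            (dn₀ AB hAB ◅◅ up₀ CB hCB ◅◅ up₁ BA hBA)
            (dn₀ AC hAC ◅◅ up₀ BC hBC ◅◅ up₁ CA hCA)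
        ... | inj₂ hCA | inj₁ hBA | inj₂ hCB | inj₁ hAC =
          clash X (ℓ₂ , B) (ℓ₃ , B) (λ ())
            (dn₁ AB hAB ◅◅ up₁ BA hBA ◅◅ up₂ AC hAC)
            (dn₁ CB hCB ◅◅ up₁ BC hBC ◅◅ up₂ CA hCA)
        ... | inj₂ hCA | inj₁ hBA | inj₂ hCB | inj₂ hAC =
          clash X (ℓ₂ , A) (ℓ₂ , B) (λ ())
            (dn₁ BA hBA ◅◅ up₁ AB hAB)
            (dn₁ CA hCA ◅◅ dn₀ BC hBC ◅◅ up₀ AC hAC ◅◅ up₁ CB hCB)
        ... | inj₂ hCA | inj₂ hBA | inj₁ hCB | inj₁ hAC =
          clash X (ℓ₀ , C) (ℓ₁ , C) (λ ())
            (up₀ AC hAC ◅◅ dn₀ AB hAB ◅◅ up₀ CB hCB)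
            (up₀ BC hBC ◅◅ dn₀ BA hBA ◅◅ up₀ CA hCA)
        ... | inj₂ hCA | inj₂ hBA | inj₁ hCB | inj₂ hAC =
          clash X (ℓ₁ , A) (ℓ₁ , C) (λ ())
            (dn₀ AB hAB ◅◅ up₀ CB hCB)
            (dn₀ AC hAC ◅◅ up₀ BC hBC ◅◅ dn₀ BA hBA ◅◅ up₀ CA hCA)
        ... | inj₂ hCA | inj₂ hBA | inj₂ hCB | inj₁ hAC =
          clash X (ℓ₀ , B) (ℓ₀ , C) (λ ())
            (up₀ AB hAB ◅◅ dn₀ AC hAC)
            (up₀ CB hCB ◅◅ dn₀ CA hCA ◅◅ up₀ BA hBA ◅◅ dn₀ BC hBC)
        ... | inj₂ hCA | inj₂ hBA | inj₂ hCB | inj₂ hAC =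
          clash X (ℓ₀ , B) (ℓ₁ , A) (λ ())
            (up₀ AB hAB)
            (up₀ CB hCB ◅◅ dn₀ CA hCA ◅◅ up₀ BA hBA ◅◅ dn₀ BC hBC ◅◅ up₀ AC hAC)

      -- Once each orientation is constant, the two orientations agree; the
      -- refuting hexagon runs from (x₀, a) to (x₃, a) through both.
      orientations : κ AB ≡ κ BC → κ BC ≡ κ CA → κ BA ≡ κ AC → κ AC ≡ κ CB → κ AB ≡ κ BA
      orientations ab=bc bc=ca ba=ac ac=cb with two-valued (κ BA) (κ AB)
      ... | inj₁ same = sym same
      ... | inj₂ other = ⊥-elim (refute refl other)
        where
        refute : ∀ {X} → κ AB ≡ X → κ BA ≡ not X → ⊥
        refute {X} hAB hBA =
          clash X (ℓ₀ , A) (ℓ₃ , A) (λ ())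
            (up₀ CA hCA ◅◅ up₁ AB hAB ◅◅ up₂ BC hBC)
            (up₀ BA hBA ◅◅ up₁ AC hAC ◅◅ up₂ CB hCB)
          where
          hBC : κ BC ≡ X
          hBC = trans (sym ab=bc) hAB
          hCA : κ CA ≡ X
          hCA = trans (sym bc=ca) hBC
          hAC : κ AC ≡ not X
          hAC = trans (sym ba=ac) hBA
          hCB : κ CB ≡ not X
          hCB = trans (sym ac=cb) hAC

    module Rigid (a b c : V H) (ab : Adj H a b) (bc : Adj H b c) (ac : Adj H a c) where
      open Triangle H a b c ab bc ac

      ab=bc : cross x₀ x₁ a b ≡ cross x₀ x₁ b c
      ab=bc = Oriented.consecutive a b c ab bc ac

      bc=ca : cross x₀ x₁ b c ≡ cross x₀ x₁ c a
      bc=ca = Oriented.consecutive b c a bc (adj-flip H ac) (adj-flip H ab)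

      ba=ac : cross x₀ x₁ b a ≡ cross x₀ x₁ a c
      ba=ac = Oriented.consecutive b a c (adj-flip H ab) ac bc

      ac=cb : cross x₀ x₁ a c ≡ cross x₀ x₁ c b
      ac=cb = Oriented.consecutive a c b ac (adj-flip H bc) ab

      ab=ba : cross x₀ x₁ a b ≡ cross x₀ x₁ b a
      ab=ba = Oriented.orientations a b c ab bc ac ab=bc bc=ca ba=ac ac=cb

      rigid : ∀ d → cross x₀ x₁ (corner (tail d)) (corner (head d)) ≡ cross x₀ x₁ a b
      rigid (A , ↻) = refl
      rigid (B , ↻) = sym ab=bc
      rigid (C , ↻) = sym (trans ab=bc bc=ca)
      rigid (B , ↺) = sym ab=ba
      rigid (A , ↺) = sym (trans ab=ba ba=ac)
      rigid (C , ↺) = sym (trans ab=ba (trans ba=ac ac=cb))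

  -- Rigidity spreads from x₀ → x₁ to every edge of G; cross-step then
  -- carries the class X along non-backtracking walks in H (stepping back in
  -- G), and these walks reach every dart of H since H has no pendent edges.
  module TriangleSpread
    (walk-G : ∀ u v → Reach (Adj G) u v) (walk-H : ∀ u v → Reach (Adj H) u v)
    (continues : ∀ {u v} → Adj H u v → ∃ λ w → Adj H v w × w ≢ u)
    {Seed : V G → V G → Set} (seed-adj : ∀ {u v} → Seed u v → Adj G u v)
    (seed-back : ∀ {u v} → Seed u v → ∃ λ t → Seed t u × t ≢ v) {s t : V G} (st : Seed s t)
    (x₀ x₁ x₂ x₃ : V G) (g₀₁ : Adj G x₀ x₁) (g₁₂ : Adj G x₁ x₂) (g₂₃ : Adj G x₂ x₃)
    (x₀≢x₂ : x₀ ≢ x₂) (x₁≢x₃ : x₁ ≢ x₃) (x₀≢x₃ : x₀ ≢ x₃)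
    (a b c : V H) (ab : Adj H a b) (bc : Adj H b c) (ac : Adj H a c) where
    open Triangle H a b c ab bc ac

    X : Bool
    X = cross x₀ x₁ a b

    Rigid : V G → V G → Set
    Rigid x y = ∀ d → cross x y (corner (tail d)) (corner (head d)) ≡ X

    rigid-step : ∀ {x y z} → Rigid x y → Adj G x y → Adj G y z → x ≢ z → Rigid y z
    rigid-step {x} {y} {z} r xy yz x≢z d =
      subst (λ e → cross y z (corner (tail e)) (corner (head e)) ≡ X) (next-prev d)
            (trans (sym (cross-step xy yz x≢z (dart-adj (prev d)) (dart-adj (next (prev d)))
                                    (turn-twice (prev d))))
                   (r (prev d)))

    rigid-flip : ∀ {x y} → Rigid x y → Rigid y x
    rigid-flip {x} {y} r d =
      trans (cls-sym (pair y (corner (head d))) (pair x (corner (tail d))))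
            (subst (λ u → cross x y (corner (head d)) (corner u) ≡ X) (head-rev d) (r (rev d)))

    RigidEntry : V G → Set
    RigidEntry v = ∃ λ u → Adj G u v × Rigid u v

    rigid-out : ∀ {v w} → RigidEntry v → Adj G v w → Rigid v w
    rigid-out {v} {w} (u , uv , r) vw with u ≟ w
    ... | yes refl = rigid-flip r
    ... | no u≢w   = rigid-step r uv vw u≢w

    rigid-everywhere : ∀ {x y} → Adj G x y → Rigid x y
    rigid-everywhere {x} xy =
      rigid-out (transport RigidEntry (λ e re → _ , e , rigid-out re e) (walk-G x₁ x)
                           (x₀ , g₀₁ , Rigidity.Rigid.rigid x₀ x₁ x₂ x₃ g₀₁ g₁₂ g₂₃ x₀≢x₂ x₁≢x₃ x₀≢x₃
                                                           a b c ab bc ac))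
                xy

    data TriangleDart : V H → V H → Set where
      tri : ∀ d → TriangleDart (corner (tail d)) (corner (head d))

    triangle-adj : ∀ {α β} → TriangleDart α β → Adj H α β
    triangle-adj (tri d) = dart-adj d

    triangle-back : ∀ {α β} → TriangleDart α β → ∃ λ γ → TriangleDart γ α × γ ≢ β
    triangle-back (tri d) =
      corner (tail (prev d)) ,
      subst (λ e → TriangleDart (corner (tail (prev d))) (corner (tail e))) (next-prev d) (tri (prev d)) ,
      subst (λ e → corner (tail (prev d)) ≢ corner (head e)) (next-prev d) (turn-twice (prev d))

    module GN = NonBacktracking G Seed seed-adj seed-back
    module HN = NonBacktracking H TriangleDart triangle-adj triangle-back

    root : ∀ {y} → Adj H a y → HN.NB a y
    root {y} ay with y ≟ b
    ... | yes refl = HN.extend (HN.seed (tri CA)) ay (λ c≡b → adj-≢ H bc (sym c≡b))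
    ... | no y≢b   = HN.extend (HN.seed (tri BA)) ay (≢-sym y≢b)

    -- Induction on the H-dart, stepping back along the G-dart.
    invariant : ∀ {α β} → HN.NB α β → ∀ {x y} → GN.NB x y → cross x y α β ≡ X
    invariant (HN.seed (tri d)) xy = rigid-everywhere (GN.NB-adj xy) d
    invariant (HN.extend αβ βγ α≢γ) yz with GN.NB-back yz
    ... | x , xy , x≢z =
      trans (sym (cross-step (GN.NB-adj xy) (GN.NB-adj yz) x≢z (HN.NB-adj αβ) βγ α≢γ)) (invariant αβ xy)

    -- Each edge of G ⊗ H is read along a reachable G-dart and an H-dart,
    -- which is reachable unless its class differs from X.
    on-pair : ∀ {x y α β} → Adj G x y → Adj H α β → cls (pair x α) (pair y β) ≡ X
    on-pair {x} {y} {α} {β} xy αβ with GN.oriented walk-G st xy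
    ... | inj₁ x→y = decidable-stable (cls _ _ Bool.≟ X)
                       (λ ≢X → every-dart (adj-flip H αβ) (λ βα → ≢X (invariant βα x→y)))
      where open HN.AllDarts walk-H continues a root
    ... | inj₂ y→x = decidable-stable (cls _ _ Bool.≟ X)
                       (λ ≢X → every-dart αβ (λ α→β → ≢X (trans (cls-sym _ _) (invariant α→β y→x))))
      where open HN.AllDarts walk-H continues a root

    monochromatic : Monochromatic S
    monochromatic e e′ = trans (edge-class e) (sym (edge-class e′))
      where
      edge-class : ∀ {i j} → Adj (G ⊗ H) i j → cls i j ≡ X
      edge-class {i} {j} e = subst₂ (λ p q → cls p q ≡ X) (pair-η i) (pair-η j) (on-pair (adj-fst e) (adj-snd e))

  -- Feeding the spreading argument: a cycle of G together with a path
  -- x₀ x₁ x₂ x₃ of four distinct vertices.  A cycle of length at least 4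
  -- contains such a path; a triangle does too, via an edge leaving it,
  -- unless G is the triangle itself and hence unicyclic.
  module FromCycle (conn-G : Connected G) (¬unicyclic : ¬ IsUnicyclicTriangle G)
    (walk-H : ∀ u v → Reach (Adj H) u v) (continues : ∀ {u v} → Adj H u v → ∃ λ w → Adj H v w × w ≢ u)
    (a b c : V H) (ab : Adj H a b) (bc : Adj H b c) (ac : Adj H a c) where

    walk-G : ∀ u v → Reach (Adj G) u v
    walk-G = proj₂ conn-G

    module OnTriangle (f : Fin 3 → V G) (cycle : IsCycle G f) where
      open CycleSeeds G f cycle

      t₀t₁ : Adj G (f zero) (f (suc zero))
      t₀t₁ = proj₁ (proj₂ (proj₂ cycle)) zero

      t₁t₂ : Adj G (f (suc zero)) (f (suc (suc zero)))
      t₁t₂ = proj₁ (proj₂ (proj₂ cycle)) (suc zero)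

      t₀t₂ : Adj G (f zero) (f (suc (suc zero)))
      t₀t₂ = adj-flip G (proj₂ (proj₂ (proj₂ cycle)))

      open Triangle G (f zero) (f (suc zero)) (f (suc (suc zero))) t₀t₁ t₁t₂ t₀t₂
        using (corner; dart-adj; turn-twice; InTriangle; in-triangle?)

      -- An edge from the corner u to an outside vertex z gives the path
      -- z, u, and the two corners following u.
      from-exit : ∀ {x z} → Adj G x z → InTriangle x → ¬ InTriangle z → Monochromatic S
      from-exit {z = z} xz (u , refl) outside =
        TriangleSpread.monochromatic walk-G walk-H continues cycle-adj cycle-back (backward zero)
          z (corner u) (corner (head (u , ↻))) (corner (head (next (u , ↻))))
          (adj-flip G xz) (dart-adj (u , ↻)) (dart-adj (next (u , ↻)))
          (λ e → outside (_ , sym e)) (turn-twice (u , ↻)) (λ e → outside (_ , sym e))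
          a b c ab bc ac

      -- Walking from the triangle to an outside vertex crosses an exit edge;
      -- if there is no outside vertex, G is unicyclic with triangle cycle.
      result : Monochromatic S
      result with any? (λ v → ¬? (in-triangle? v))
      ... | yes (v , outside) with crossing in-triangle? (walk-G (f zero) v) (A , refl) outside
      ...   | x , z , xz , inside , out = from-exit xz inside out
      result | no none =
        ⊥-elim (¬unicyclic (conn-G , f zero , f (suc zero) , f (suc (suc zero)) , (t₀t₁ , t₁t₂ , t₀t₂) ,
                            λ _ g _ i → member (g i)))
        where
        member : ∀ v → (v ≡ f zero) ⊎ (v ≡ f (suc zero)) ⊎ (v ≡ f (suc (suc zero)))
        member v with decidable-stable (in-triangle? v) (λ out → none (v , out))
        ... | A , e = inj₁ (sym e)
        ... | B , e = inj₂ (inj₁ (sym e))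
        ... | C , e = inj₂ (inj₂ (sym e))

    from-cycle : ∀ m (f : Fin (suc m) → V G) → IsCycle G f → Monochromatic S
    from-cycle zero             f (() , _)
    from-cycle (suc zero)       f (s≤s () , _)
    from-cycle (suc (suc zero)) f cycle = OnTriangle.result f cycle
    from-cycle (suc (suc (suc m))) f cycle@(_ , injective , adjs , _) =
      TriangleSpread.monochromatic walk-G walk-H continues cycle-adj cycle-back (backward zero)
        (f zero) (f (suc zero)) (f (suc (suc zero))) (f (suc (suc (suc zero))))
        (adjs zero) (adjs (suc zero)) (adjs (suc (suc zero)))
        (Fin.0≢1+n ∘ injective) (Fin.0≢1+n ∘ Fin.suc-injective ∘ injective) (Fin.0≢1+n ∘ injective)
        a b c ab bc ac
      where open CycleSeeds G f cycle

part₂ : ∀ (G : Graph) (n : ℕ) → Connected G → 2 ≤ size G → 5 ≤ n → md≡ (G ⊗ K n) 1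
part₂ G n conn two five with some-edge G conn two | two-elements {n} (≤-trans (s≤s (s≤s z≤n)) five)
... | x , y , xy | a , b , a≢b =
  md≡1 (G ⊗ K n) (Product.pair-adj G (K n) {α = a} {β = b} xy (K-adj a≢b))
       (λ S → CompleteFactor.monochromatic G n five S conn xy)

-- A connected graph that is not a tree has an edge: otherwise no cycle
-- could exist.
edge-of-non-tree : (G : Graph) → Connected G → ¬ IsTree G → ∃₂ λ x y → Adj G x y
edge-of-non-tree G conn ¬tree with any? (λ x → any? (λ y → adj G x y Bool.≟ true))
... | yes (x , y , xy) = x , y , xy
... | no none = ⊥-elim (¬tree (conn , λ { _ _ (s≤s _ , _ , adjs , _) → none (_ , _ , adjs zero) }))

-- Two edges
-- of different classes would make G acyclic, since every cycle forces all
-- edges into one class.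
part₁ : ∀ (G H : Graph) → Connected G → Connected H → ¬ IsTree G → ¬ IsUnicyclicTriangle G →
        HasTriangle H → NoPendentEdges H → md≡ (G ⊗ H) 1
part₁ G H conn-G conn-H ¬tree ¬unicyclic (a , b , c , ab , bc , ac) no-pendent
  with edge-of-non-tree G conn-G ¬tree
... | x , y , xy = md≡1 (G ⊗ H) (Product.pair-adj G H xy ab) monochromatic
  where
  monochromatic : (S : Split (G ⊗ H)) → Monochromatic S
  monochromatic S e e′ =
    decidable-stable (_ Bool.≟ _) λ differ →
      ¬tree (conn-G , λ m f cycle → differ (from-cycle m f cycle e e′))
    where
    open TensorFacts G H S
    open FromCycle conn-G ¬unicyclic (proj₂ conn-H) (continue H no-pendent) a b c ab bc ac

corollary4p11 :
    (∀ (G H : Graph) → Connected G → Connected H →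
       ¬ IsTree G → ¬ IsUnicyclicTriangle G →
       HasTriangle H → NoPendentEdges H →
       md≡ (G ⊗ H) 1)
    × (∀ (G : Graph) (n : ℕ) → Connected G → 2 ≤ size G → 5 ≤ n →
       md≡ (G ⊗ K n) 1)
corollary4p11 = part₁ , part₂
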